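{- Let $\sigma\in I(321)$ be a simple involution without fixed points, $\sigma=(m_1,M_1)\cdots(m_m,M_m)$ with $m_i<M_i$, $m_1<\cdots<m_m$, $M_1<\cdots<M_m$. Then the plot of $\sigma$ contains no couple of symmetric connections: for every $1\le i<m$, if the maxima $M_i$ and $M_{i+1}$ are up-connected then the corresponding minima $m_i$ and $m_{i+1}$ are not down-connected.
   Context: A permutation of length $n$ is a bijection of $\{1,\dots,n\}$ in one-line notation. A permutation avoids $321$ if it has no indices $i<j<k$ with $\pi(i)>\pi(j)>\pi(k)$. An involution satisfies $\pi(\pi(i))=i$ for all $i$; $I(321)$ is the set of involutions avoiding $321$. An interval of a permutation of length $n$ is a set of contiguous positions whose image is a set of contiguous integers; a permutation is simple if its only intervals are the empty set, singletons and $[1,n]$. For an involution $\pi$ of length $n$ without fixed points, the plot is the polygonal line joining $(1,\pi(1)),\dots,(n,\pi(n))$ in order; maxima are the values $M_i$ (points $(m_i,M_i)$ above $y=x$), minima the values $m_i$ (points $(M_i,m_i)$ below $y=x$). Two maxima (resp. minima) are up-connected (resp. down-connected) if they occur at consecutive positions of $\pi$, i.e. are joined by one segment of the plot. A couple of symmetric connections is an up-connection between two maxima together with a down-connection between the two minima that are their mirror images in the line $y=x$. -}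

module Defs where

open import Data.Nat using (ℕ; zero; suc; _≤_; _<_)
open import Data.Fin using (Fin; toℕ)
open import Data.Fin.Permutation using (Permutation′; _⟨$⟩ʳ_)
open import Data.Product using (Σ; _×_; ∃)
open import Data.Sum using (_⊎_)
open import Relation.Binary.PropositionalEquality using (_≡_; _≢_)
open import Relation.Nullary using (¬_)

-- Positions and values are Fin n (0-based); σ ⟪ i ⟫ is the value at position i, as a natural number.
_⟪_⟫ : ∀ {n} → Permutation′ n → Fin n → ℕ
σ ⟪ i ⟫ = toℕ (σ ⟨$⟩ʳ i)

IsInvolution : ∀ {n} → Permutation′ n → Set
IsInvolution σ = ∀ i → σ ⟨$⟩ʳ (σ ⟨$⟩ʳ i) ≡ i

FixedPointFree : ∀ {n} → Permutation′ n → Set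
FixedPointFree σ = ∀ i → σ ⟨$⟩ʳ i ≢ i

Avoids321 : ∀ {n} → Permutation′ n → Set
Avoids321 {n} σ = ∀ (i j k : Fin n) → toℕ i < toℕ j → toℕ j < toℕ k →
  ¬ (σ ⟪ k ⟫ < σ ⟪ j ⟫ × σ ⟪ j ⟫ < σ ⟪ i ⟫)

IsInterval : ∀ {n} → Permutation′ n → ℕ → ℕ → Set
IsInterval {n} σ lo hi = ∀ (j k : Fin n) (v : ℕ) →
  lo ≤ toℕ j → toℕ j ≤ hi → lo ≤ toℕ k → toℕ k ≤ hi →
  σ ⟪ j ⟫ ≤ v → v ≤ σ ⟪ k ⟫ →
  Σ (Fin n) (λ l → lo ≤ toℕ l × toℕ l ≤ hi × σ ⟪ l ⟫ ≡ v)

-- simple: the only intervals are the empty set, singletons and the whole range [0, n-1]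
-- (the empty set corresponds to lo > hi and is excluded by the hypothesis lo ≤ hi)
IsSimple : ∀ {n} → Permutation′ n → Set
IsSimple {n} σ = ∀ (lo hi : ℕ) → lo ≤ hi → hi < n → IsInterval σ lo hi →
  lo ≡ hi ⊎ (lo ≡ 0 × suc hi ≡ n)

module Submission where

-- Let a, b = a+1 be consecutive positions holding maxima
-- σ a, σ b (points above the diagonal; the up-connection) whose values are
-- consecutive (the mirrored down-connection of the minima).  Then the two
-- positions {a, a+1} carry the two values {p, p+1}: they form an interval
-- of σ of size two.  Simplicity forces this interval to be the whole
-- range, so b is the last position n-1.  But b holds a maximum, i.e.
-- b < σ b, which is impossible at the last position since σ b ≤ n-1.

open import Defs
open import Data.Nat using (ℕ; suc; _<_; _≤_; s≤s)
open import Data.Nat.Properties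
  using (≤-antisym; ≤-reflexive; ≤-trans; n≤1+n; m≤n⇒m<n∨m≡n; m<1+n⇒m≤n; 1+n≢n; <⇒≱)
open import Data.Fin using (Fin; toℕ)
open import Data.Fin.Properties using (toℕ-injective; toℕ<n)
open import Data.Fin.Permutation using (Permutation′)
open import Data.Product using (_×_; _,_; proj₁; proj₂)
open import Data.Sum using (_⊎_; inj₁; inj₂; swap)
open import Data.Empty using (⊥-elim)
open import Relation.Binary.PropositionalEquality using (_≡_; refl; sym; trans; subst)
open import Relation.Nullary using (¬_)

≤-suc-cases : ∀ {p v : ℕ} → p ≤ v → v ≤ suc p → v ≡ p ⊎ v ≡ suc p
≤-suc-cases p≤v v≤1+p with m≤n⇒m<n∨m≡n v≤1+p
... | inj₁ (s≤s v≤p) = inj₁ (≤-antisym v≤p p≤v)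
... | inj₂ v≡1+p     = inj₂ v≡1+p

InWindow : ∀ {n} → ℕ → Fin n → Set
InWindow lo j = lo ≤ toℕ j × toℕ j ≤ suc lo

module _ {n : ℕ} {a b : Fin n} (b≡a+1 : toℕ b ≡ suc (toℕ a)) where

  window-cases : ∀ j → InWindow (toℕ a) j → j ≡ a ⊎ j ≡ b
  window-cases j (a≤j , j≤a+1) with ≤-suc-cases a≤j j≤a+1
  ... | inj₁ j≡a   = inj₁ (toℕ-injective j≡a)
  ... | inj₂ j≡a+1 = inj₂ (toℕ-injective (trans j≡a+1 (sym b≡a+1)))

  a-in-window : InWindow (toℕ a) a
  a-in-window = ≤-reflexive refl , n≤1+n (toℕ a)

  b-in-window : InWindow (toℕ a) b
  b-in-window = subst (toℕ a ≤_) (sym b≡a+1) (n≤1+n (toℕ a)) , ≤-reflexive b≡a+1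

module _ {n : ℕ} (σ : Permutation′ n) {lo p : ℕ} {x y : Fin n}
         (covers : ∀ j → InWindow lo j → j ≡ x ⊎ j ≡ y)
         (x∈ : InWindow lo x) (y∈ : InWindow lo y)
         (σx≡p : σ ⟪ x ⟫ ≡ p) (σy≡p+1 : σ ⟪ y ⟫ ≡ suc p) where

  value-lower : ∀ {j} → j ≡ x ⊎ j ≡ y → p ≤ σ ⟪ j ⟫
  value-lower (inj₁ refl) = ≤-reflexive (sym σx≡p)
  value-lower (inj₂ refl) = subst (p ≤_) (sym σy≡p+1) (n≤1+n p)

  value-upper : ∀ {j} → j ≡ x ⊎ j ≡ y → σ ⟪ j ⟫ ≤ suc p
  value-upper (inj₁ refl) = subst (_≤ suc p) (sym σx≡p) (n≤1+n p)
  value-upper (inj₂ refl) = ≤-reflexive σy≡p+1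

  pair-interval : IsInterval σ lo (suc lo)
  pair-interval j k v lo≤j j≤hi lo≤k k≤hi σj≤v v≤σk
    with ≤-suc-cases (≤-trans (value-lower (covers j (lo≤j , j≤hi))) σj≤v)
                     (≤-trans v≤σk (value-upper (covers k (lo≤k , k≤hi))))
  ... | inj₁ refl = x , proj₁ x∈ , proj₂ x∈ , σx≡p
  ... | inj₂ refl = y , proj₁ y∈ , proj₂ y∈ , σy≡p+1

adjacent-pair-interval : ∀ {n} (σ : Permutation′ n) {a b : Fin n} →
  toℕ b ≡ suc (toℕ a) →
  σ ⟪ b ⟫ ≡ suc (σ ⟪ a ⟫) ⊎ σ ⟪ a ⟫ ≡ suc (σ ⟪ b ⟫) →
  IsInterval σ (toℕ a) (suc (toℕ a))
adjacent-pair-interval σ b≡a+1 (inj₁ σb≡σa+1) =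
  pair-interval σ (window-cases b≡a+1)
    (a-in-window b≡a+1) (b-in-window b≡a+1) refl σb≡σa+1
adjacent-pair-interval σ b≡a+1 (inj₂ σa≡σb+1) =
  pair-interval σ (λ j j∈ → swap (window-cases b≡a+1 j j∈))
    (b-in-window b≡a+1) (a-in-window b≡a+1) refl σa≡σb+1

simple-pair-is-everything : ∀ {n} (σ : Permutation′ n) {lo : ℕ} →
  IsSimple σ → suc lo < n → IsInterval σ lo (suc lo) → suc (suc lo) ≡ n
simple-pair-is-everything σ {lo} simple lo+1<n interval
  with simple lo (suc lo) (n≤1+n lo) lo+1<n interval
... | inj₁ lo≡lo+1       = ⊥-elim (1+n≢n (sym lo≡lo+1))
... | inj₂ (_ , lo+2≡n) = lo+2≡n

last-position-bound : ∀ {n} (σ : Permutation′ n) (i : Fin n) →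
  suc (toℕ i) ≡ n → σ ⟪ i ⟫ ≤ toℕ i
last-position-bound σ i i+1≡n =
  m<1+n⇒m≤n (subst (σ ⟪ i ⟫ <_) (sym i+1≡n) (toℕ<n _))

proposition6p2 : ∀ (n : ℕ) (σ : Permutation′ n) →
    IsInvolution σ → Avoids321 σ → IsSimple σ → FixedPointFree σ →
    ∀ (a b : Fin n) →
    toℕ b ≡ suc (toℕ a) →
    toℕ a < σ ⟪ a ⟫ → toℕ b < σ ⟪ b ⟫ →
    ¬ (σ ⟪ b ⟫ ≡ suc (σ ⟪ a ⟫) ⊎ σ ⟪ a ⟫ ≡ suc (σ ⟪ b ⟫))
proposition6p2 n σ _ _ simple _ a b b≡a+1 _ b-below-σb adjacent-values =
  <⇒≱ b-below-σb (last-position-bound σ b b-is-last)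
  where
    b-is-last : suc (toℕ b) ≡ n
    b-is-last = subst (λ t → suc t ≡ n) (sym b≡a+1)
      (simple-pair-is-everything σ simple (subst (_< n) b≡a+1 (toℕ<n b))
        (adjacent-pair-interval σ b≡a+1 adjacent-values))
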